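{- For any positive integers $n,m$ and any $\epsilon>0$ there exists a sufficiently large integer $N$ with the following property. For any oblivious single-item OCRS $A$ on items $[N]$ (arriving in order $1,\dots,N$), there exist a subset $S\subseteq[N]$ with $|S|=m$ and a counting-based strategy with probability sequence $(p_1,p_2,\dots)$ such that $f_A(T)\in[p_{|T|},\,p_{|T|}+\epsilon]$ for every nonempty $T\subseteq S$ with $|T|\le n$. In other words, $A$ is $(\epsilon,n)$-approximate to that counting-based strategy on $S$.
   Context: Single-item setting: items $1,\dots,N$ arrive in order, and item $i$ is active independently with probability $x_i$, where $x_i\ge0$ and $\sum_i x_i\le 1$. On arrival it is revealed whether the item is active, and an active item may be irrevocably accepted; at most one item may be accepted in total. An OCRS is oblivious if its acceptance probabilities do not depend on $\mathbf{x}$. Such an oblivious OCRS $A$ is described by a function $f_A:2^{[N]}\setminus\{\emptyset\}\to[0,1]$. For nonempty $T\subseteq[N]$, $f_A(T)$ is the probability that $A$ accepts item $i=\max T$ at step $i$, given that $T$ is exactly the set of active items among $1,\dots,i$ and that $A$ has not accepted any item before step $i$. A counting-based strategy is specified by a sequence $(p_1,p_2,\dots)$ in $[0,1]$. It accepts the $k$-th active item, if nothing has been accepted before, with probability $p_k$; equivalently, its function is $f(T)=p_{|T|}$.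
   Formalization: The values $f_A(T)$ of the oblivious OCRS and the parameter ε are rational, and the probability sequence of the counting-based strategy is taken in the rationals. -}

module Defs where

open import Data.Nat using (ℕ)
open import Data.Product using (_×_)
open import Data.Rational using (ℚ; 0ℚ; 1ℚ; _≤_; _+_)
open import Data.Fin.Subset using (Subset; _⊆_; ∣_∣; Nonempty)

-- Items [N] are represented by Fin N (item i+1 ↦ index i, order preserved);
-- subsets of [N] are Data.Fin.Subset.Subset N.

-- An oblivious single-item OCRS A on items [N] is described by its function
-- f_A : 2^[N] \ {∅} → [0,1].  We represent it as a function on all subsets
-- whose values on nonempty subsets lie in [0,1] (the value on ∅ is irrelevant).
record ObliviousOCRS (N : ℕ) : Set where
  field
    f     : Subset N → ℚ
    f-≥0  : ∀ (T : Subset N) → Nonempty T → 0ℚ ≤ f T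
    f-≤1  : ∀ (T : Subset N) → Nonempty T → f T ≤ 1ℚ

-- A counting-based strategy: a sequence (p₁, p₂, …) of probabilities in [0,1]
-- (index 0 is unused), with function f(T) = p_{|T|}.
record CountingStrategy : Set where
  field
    p     : ℕ → ℚ
    p-≥0  : ∀ k → 0ℚ ≤ p k
    p-≤1  : ∀ k → p k ≤ 1ℚ

countingFun : ∀ {N} → CountingStrategy → Subset N → ℚ
countingFun c T = CountingStrategy.p c ∣ T ∣

ApproxOn : ∀ {N} → ℚ → ℕ → ObliviousOCRS N → CountingStrategy → Subset N → Set
ApproxOn {N} ε n A c S =
  ∀ (T : Subset N) → T ⊆ S → Nonempty T → ∣ T ∣ Data.Nat.≤ n →
    (countingFun c T ≤ ObliviousOCRS.f A T) ×
    (ObliviousOCRS.f A T ≤ countingFun c T + ε)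

{-# OPTIONS --safe #-}

-- Round f_A down to the grid {0, ε, 2ε, …} ∩ [0,1]: the grid index is a colouring of the subsets
-- of [N] with finitely many colours.  By the finite Ramsey theorem for colourings of all sets of
-- size ≤ n, a large [N] contains an m-set S on which the colour of T ⊆ S, |T| ≤ n, depends only on
-- |T|; the grid values of these colours form a counting strategy lying at most ε below f_A on S.
--
-- Ramsey's theorem is proved by induction on n, following Erdős and Rado: pick elements x₁, x₂, …
-- greedily, passing after each xᵢ to a large set homogeneous (by induction) for T ↦ χ({xᵢ} ∪ T).
-- Then the colour of a set T of picked elements depends only on |T| and on its earliest-picked
-- element, its leader; pigeonholing the leaders by their colour labels for each of the n + 1 sizes
-- leaves a set homogeneous for all sizes ≤ n + 1.

module Submission where

open import Defs
open import Data.Nat using (ℕ; _≥_; _≤_; NonZero)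
open import Data.Product using (Σ; ∃; _×_)
open import Data.Rational using (ℚ; 0ℚ; _<_)
open import Data.Fin.Subset using (Subset; ∣_∣)
open import Relation.Binary.PropositionalEquality using (_≡_)

open import Data.Bool using (if_then_else_)
open import Data.Fin using (Fin; zero; suc)
import Data.Fin as Fin
open import Data.Fin.Subset
  using (inside; outside; ⊥; ⊤; ⁅_⁆; _∪_; _─_; _-_; _∈_; _∉_; _⊆_; Nonempty; Empty)
open import Data.Fin.Subset.Properties
  using (_∈?_; nonempty?; ∉⊥; ⊥⊆; ∣⊥∣≡0; ∣⊤∣≡n; ∪-identityˡ; p─⊥≡p; p─q⊆p; x∈p∪q⁻; x∈⁅y⁆⇒x≡y;
         Empty-unique; x∈p⇒∣p-x∣<∣p∣; p⊆q⇒∣p∣≤∣q∣)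
open import Data.Integer as ℤ using (+_; +[1+_])
import Data.Integer.Properties as ℤₚ
open import Data.Integer.Tactic.RingSolver using (solve-∀)
open import Data.Nat using (zero; suc; pred; _+_; _*_; _^_; _⊔_; z≤n; s≤s)
import Data.Nat as ℕ
import Data.Nat.Properties as ℕₚ
open import Data.Product using (_,_; proj₁; proj₂)
import Data.Rational as ℚ
open import Data.Rational using (mkℚ; 1ℚ; toℚᵘ; *<*)
import Data.Rational.Properties as ℚₚ
open import Data.Rational.Unnormalised as ℚᵘ using (mkℚᵘ; *≡*; *≤*) renaming (_≃_ to _≃ᵘ_)
import Data.Rational.Unnormalised.Properties as ℚᵘₚ
open import Algebra.Definitions.RawMonoid ℚ.+-0-rawMonoid using () renaming (_×_ to _·_)
open import Algebra.Definitions.RawMonoid ℚᵘ.+-0-rawMonoid using () renaming (_×_ to _·ᵘ_)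
open import Data.Sum using (_⊎_; inj₁; inj₂)
import Data.Sum as Sum
open import Data.Vec using ([]; _∷_; here; there)
open import Data.Vec.Functional using (updateAt)
open import Data.Vec.Functional.Properties using (updateAt-updates; updateAt-minimal)
open import Function using (_∘_; id; const)
open import Level using (Level)
open import Relation.Binary.PropositionalEquality
  using (_≢_; refl; sym; trans; cong; cong-app; subst; subst₂; module ≡-Reasoning)
open import Relation.Nullary using (¬_; yes; no; does; contradiction; _×-dec_)
open import Relation.Unary using (Pred; Decidable)
open import Relation.Unary.Properties using (∁?)

open ObliviousOCRS using (f; f-≥0; f-≤1)

private
  variable
    ℓ : Level
    N : ℕ
    x y : Fin N
    p q : Subset N

x∉p-x : ∀ (p : Subset N) x → x ∉ p - x
x∉p-x (s ∷ p) zero    ()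
x∉p-x (s ∷ p) (suc x) (there x∈p-x) = x∉p-x p x x∈p-x

x∈p⇒⁅x⁆∪p-x≡p : x ∈ p → ⁅ x ⁆ ∪ (p - x) ≡ p
x∈p⇒⁅x⁆∪p-x≡p {p = inside ∷ p} here        = cong (inside ∷_) (trans (∪-identityˡ (p ─ ⊥)) (p─⊥≡p p))
x∈p⇒⁅x⁆∪p-x≡p {p = s ∷ p}      (there x∈p) = cong (s ∷_) (x∈p⇒⁅x⁆∪p-x≡p x∈p)

∣⁅x⁆∪p∣≡1+∣p∣ : x ∉ p → ∣ ⁅ x ⁆ ∪ p ∣ ≡ suc ∣ p ∣
∣⁅x⁆∪p∣≡1+∣p∣ {x = zero}  {p = outside ∷ p} x∉p = cong (suc ∘ ∣_∣) (∪-identityˡ p)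
∣⁅x⁆∪p∣≡1+∣p∣ {x = zero}  {p = inside ∷ p}  x∉p = contradiction here x∉p
∣⁅x⁆∪p∣≡1+∣p∣ {x = suc x} {p = outside ∷ p} x∉p = ∣⁅x⁆∪p∣≡1+∣p∣ (x∉p ∘ there)
∣⁅x⁆∪p∣≡1+∣p∣ {x = suc x} {p = inside ∷ p}  x∉p = cong suc (∣⁅x⁆∪p∣≡1+∣p∣ (x∉p ∘ there))

x∈p⇒∣p∣≡1+∣p-x∣ : x ∈ p → ∣ p ∣ ≡ suc ∣ p - x ∣
x∈p⇒∣p∣≡1+∣p-x∣ {x = x} {p = p} x∈p = begin
  ∣ p ∣                 ≡⟨ cong ∣_∣ (x∈p⇒⁅x⁆∪p-x≡p x∈p) ⟨
  ∣ ⁅ x ⁆ ∪ (p - x) ∣   ≡⟨ ∣⁅x⁆∪p∣≡1+∣p∣ (x∉p-x p x) ⟩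
  suc ∣ p - x ∣         ∎
  where open ≡-Reasoning

x∈⁅y⁆∪p⁻ : x ∈ ⁅ y ⁆ ∪ p → x ≡ y ⊎ x ∈ p
x∈⁅y⁆∪p⁻ {y = y} {p = p} = Sum.map₁ (x∈⁅y⁆⇒x≡y y) ∘ x∈p∪q⁻ ⁅ y ⁆ p

p⊆⁅x⁆∪q∧x∉p⇒p⊆q : p ⊆ ⁅ x ⁆ ∪ q → x ∉ p → p ⊆ q
p⊆⁅x⁆∪q∧x∉p⇒p⊆q p⊆⁅x⁆∪q x∉p y∈p with x∈⁅y⁆∪p⁻ (p⊆⁅x⁆∪q y∈p)
... | inj₁ refl = contradiction y∈p x∉p
... | inj₂ y∈q  = y∈q

x∈q∧p⊆q⇒⁅x⁆∪p⊆q : x ∈ q → p ⊆ q → ⁅ x ⁆ ∪ p ⊆ q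
x∈q∧p⊆q⇒⁅x⁆∪p⊆q x∈q p⊆q y∈⁅x⁆∪p with x∈⁅y⁆∪p⁻ y∈⁅x⁆∪p
... | inj₁ refl = x∈q
... | inj₂ y∈p  = p⊆q y∈p

∣p∣≡0⇒p≡⊥ : ∣ p ∣ ≡ 0 → p ≡ ⊥
∣p∣≡0⇒p≡⊥ {p = []}          _     = refl
∣p∣≡0⇒p≡⊥ {p = outside ∷ p} ∣p∣≡0 = cong (outside ∷_) (∣p∣≡0⇒p≡⊥ ∣p∣≡0)

Empty∧∣p∣≡∣q∣⇒p≡q : {p q : Subset N} → Empty p → ∣ p ∣ ≡ ∣ q ∣ → p ≡ q
Empty∧∣p∣≡∣q∣⇒p≡q {N} p-empty ∣p∣≡∣q∣ with refl ← Empty-unique p-empty =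
  sym (∣p∣≡0⇒p≡⊥ (trans (sym ∣p∣≡∣q∣) (∣⊥∣≡0 N)))

Nonempty⇒∣p∣>0 : Nonempty p → 0 ℕ.< ∣ p ∣
Nonempty⇒∣p∣>0 (x , x∈p) = ℕₚ.≤-<-trans z≤n (x∈p⇒∣p-x∣<∣p∣ x∈p)

∣p∣>0⇒Nonempty : 0 ℕ.< ∣ p ∣ → Nonempty p
∣p∣>0⇒Nonempty {p = inside ∷ p}  _     = zero , here
∣p∣>0⇒Nonempty {p = outside ∷ p} 0<∣p∣ = let x , x∈p = ∣p∣>0⇒Nonempty 0<∣p∣ in suc x , there x∈p

prefix : ℕ → Subset N → Subset N
prefix zero    p             = ⊥
prefix (suc k) []            = []
prefix (suc k) (inside ∷ p)  = inside ∷ prefix k p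
prefix (suc k) (outside ∷ p) = outside ∷ prefix (suc k) p

prefix⊆ : ∀ k {p : Subset N} → prefix k p ⊆ p
prefix⊆ zero                                = ⊥⊆
prefix⊆ (suc k) {p = inside ∷ p}  here       = here
prefix⊆ (suc k) {p = inside ∷ p}  (there x∈) = there (prefix⊆ k x∈)
prefix⊆ (suc k) {p = outside ∷ p} (there x∈) = there (prefix⊆ (suc k) x∈)

∣prefix∣≡ : ∀ k {p : Subset N} → k ≤ ∣ p ∣ → ∣ prefix k p ∣ ≡ k
∣prefix∣≡ {N} zero                  _        = ∣⊥∣≡0 N
∣prefix∣≡ (suc k) {p = inside ∷ p}  (s≤s k≤) = cong suc (∣prefix∣≡ k {p} k≤)
∣prefix∣≡ (suc k) {p = outside ∷ p} k<       = ∣prefix∣≡ (suc k) {p} k<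

filter : {P : Pred (Fin N) ℓ} → Decidable P → Subset N → Subset N
filter P? []      = []
filter P? (s ∷ p) = (if does (P? zero) then s else outside) ∷ filter (P? ∘ suc) p

filter⊆ : {P : Pred (Fin N) ℓ} (P? : Decidable P) → filter P? p ⊆ p
filter⊆ {p = s ∷ p} P? {zero} x∈ with P? zero
filter⊆ {p = s ∷ p} P? {zero} here | yes _ = here
filter⊆ {p = s ∷ p} P? {zero} ()   | no  _
filter⊆ {p = s ∷ p} P? {suc x} (there x∈)   = there (filter⊆ (P? ∘ suc) x∈)

x∈filter⇒Px : {P : Pred (Fin N) ℓ} (P? : Decidable P) → x ∈ filter P? p → P x
x∈filter⇒Px {x = zero} {p = s ∷ p} P? x∈ with P? zero
x∈filter⇒Px {x = zero} {p = s ∷ p} P? here | yes Px = Px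
x∈filter⇒Px {x = zero} {p = s ∷ p} P? ()   | no  _
x∈filter⇒Px {x = suc x} {p = s ∷ p} P? (there x∈)  = x∈filter⇒Px (P? ∘ suc) x∈

∣filter∣+∣filter-∁∣≡∣p∣ : {P : Pred (Fin N) ℓ} (P? : Decidable P) (p : Subset N) →
                          ∣ filter P? p ∣ + ∣ filter (∁? P?) p ∣ ≡ ∣ p ∣
∣filter∣+∣filter-∁∣≡∣p∣ P? []      = refl
∣filter∣+∣filter-∁∣≡∣p∣ P? (s ∷ p) with P? zero | ∣filter∣+∣filter-∁∣≡∣p∣ (P? ∘ suc) p
∣filter∣+∣filter-∁∣≡∣p∣ P? (outside ∷ p) | yes _ | IH = IH
∣filter∣+∣filter-∁∣≡∣p∣ P? (outside ∷ p) | no _  | IH = IH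
∣filter∣+∣filter-∁∣≡∣p∣ P? (inside ∷ p)  | yes _ | IH = cong suc IH
∣filter∣+∣filter-∁∣≡∣p∣ P? (inside ∷ p)  | no _  | IH = trans (ℕₚ.+-suc _ _) (cong suc IH)

ConstantOn : (Fin N → ℕ) → Subset N → Set
ConstantOn g p = ∀ {x y} → x ∈ p → y ∈ p → g x ≡ g y

pigeonhole : ∀ c a (g : Fin N → ℕ) → (∀ {x} → x ∈ p → g x ≤ c) → suc c * a ≤ ∣ p ∣ →
             ∃ λ q → q ⊆ p × a ≤ ∣ q ∣ × ConstantOn g q
pigeonhole {p = p} zero a g g≤0 a+0≤∣p∣ =
  p , id , subst (_≤ ∣ p ∣) (ℕₚ.+-identityʳ a) a+0≤∣p∣ ,
  λ x∈p y∈p → trans (ℕₚ.n≤0⇒n≡0 (g≤0 x∈p)) (sym (ℕₚ.n≤0⇒n≡0 (g≤0 y∈p)))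
pigeonhole {p = p} (suc c) a g g≤ size with a ℕₚ.≤? ∣ filter (λ x → g x ℕₚ.≟ suc c) p ∣
... | yes a≤∣fibre∣ =
  _ , filter⊆ _ , a≤∣fibre∣ , λ x∈ y∈ → trans (x∈filter⇒Px _ x∈) (sym (x∈filter⇒Px _ y∈))
... | no a≰∣fibre∣ =
  let q , q⊆rest , a≤∣q∣ , constant = pigeonhole c a g g≤c size-rest
  in  q , filter⊆ _ ∘ q⊆rest , a≤∣q∣ , constant
  where
  fibre? : Decidable (λ x → g x ≡ suc c)
  fibre? x = g x ℕₚ.≟ suc c

  rest : Subset _
  rest = filter (∁? fibre?) p

  g≤c : ∀ {x} → x ∈ rest → g x ≤ c
  g≤c x∈ = ℕₚ.≤-pred (ℕₚ.≤∧≢⇒< (g≤ (filter⊆ _ x∈)) (x∈filter⇒Px _ x∈))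

  size-rest : suc c * a ≤ ∣ rest ∣
  size-rest = ℕₚ.+-cancelˡ-≤ a _ _ (begin
    a + suc c * a                  ≤⟨ size ⟩
    ∣ p ∣                           ≡⟨ ∣filter∣+∣filter-∁∣≡∣p∣ fibre? p ⟨
    ∣ filter fibre? p ∣ + ∣ rest ∣  ≤⟨ ℕₚ.+-monoˡ-≤ ∣ rest ∣ (ℕₚ.<⇒≤ (ℕₚ.≰⇒> a≰∣fibre∣)) ⟩
    a + ∣ rest ∣                    ∎)
    where open ℕₚ.≤-Reasoning

pigeonhole-levels : ∀ c j a (t : Fin N → ℕ → ℕ) → (∀ x k → t x k ≤ c) → suc c ^ j * a ≤ ∣ p ∣ →
                    ∃ λ q → q ⊆ p × a ≤ ∣ q ∣ × (∀ k → k ℕ.< j → ConstantOn (λ x → t x k) q)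
pigeonhole-levels {p = p} c zero a t t≤c size =
  p , id , subst (_≤ ∣ p ∣) (ℕₚ.*-identityˡ a) size , λ _ ()
pigeonhole-levels {p = p} c (suc j) a t t≤c size
  with q₁ , q₁⊆p , size₁ , constant-j ←
         pigeonhole c (suc c ^ j * a) (λ x → t x j) (λ _ → t≤c _ j)
                    (subst (_≤ ∣ p ∣) (ℕₚ.*-assoc (suc c) (suc c ^ j) a) size)
  with q₂ , q₂⊆q₁ , size₂ , constant-<j ← pigeonhole-levels c j a t t≤c size₁
  = q₂ , q₁⊆p ∘ q₂⊆q₁ , size₂ , constant-≤j
  where
  constant-≤j : ∀ k → k ℕ.< suc j → ConstantOn (λ x → t x k) q₂
  constant-≤j k k<1+j with ℕₚ.m<1+n⇒m<n∨m≡n k<1+j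
  ... | inj₁ k<j  = constant-<j k k<j
  ... | inj₂ refl = λ x∈ y∈ → constant-j (q₂⊆q₁ x∈) (q₂⊆q₁ y∈)

SizeHomogeneous : ℕ → (Subset N → ℕ) → Subset N → Set
SizeHomogeneous n χ s = ∀ {p q} → p ⊆ s → q ⊆ s → ∣ p ∣ ≡ ∣ q ∣ → ∣ p ∣ ≤ n → χ p ≡ χ q

SizeHomogeneous-⊆ : ∀ {n χ} {s h : Subset N} → s ⊆ h → SizeHomogeneous n χ h → SizeHomogeneous n χ s
SizeHomogeneous-⊆ s⊆h homogeneous p⊆s q⊆s = homogeneous (s⊆h ∘ p⊆s) (s⊆h ∘ q⊆s)

Ramsey : ℕ → Set
Ramsey n = ∀ m c → ∃ λ K → ∀ {N} (χ : Subset N → ℕ) → (∀ p → χ p ≤ c) → ∀ s → K ≤ ∣ s ∣ →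
           ∃ λ h → h ⊆ s × m ≤ ∣ h ∣ × SizeHomogeneous n χ h

ramsey-zero : Ramsey 0
ramsey-zero m c = m , λ χ _ s m≤∣s∣ → s , id , m≤∣s∣ , λ {p} {q} _ _ ∣p∣≡∣q∣ ∣p∣≤0 →
  let ∣p∣≡0 = ℕₚ.n≤0⇒n≡0 ∣p∣≤0
  in  cong χ (trans (∣p∣≡0⇒p≡⊥ ∣p∣≡0) (sym (∣p∣≡0⇒p≡⊥ (trans (sym ∣p∣≡∣q∣) ∣p∣≡0))))

leaderColour : (Subset N → ℕ) → Fin N → Subset N → ℕ → ℕ
leaderColour χ x q k = χ (⁅ x ⁆ ∪ prefix k q)

LeaderDetermined : ℕ → (Subset N → ℕ) → (Fin N → ℕ → ℕ) → Subset N → Set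
LeaderDetermined n χ t s = ∀ {p} → p ⊆ s → Nonempty p → ∣ p ∣ ≤ suc n →
                           ∃ λ x → x ∈ p × χ p ≡ t x (pred ∣ p ∣)

module _ {N n : ℕ} {χ : Subset N → ℕ} where

  LeaderDetermined-⁅x⁆∪ : ∀ {t x q s} → x ∉ q → s ⊆ q → n ≤ ∣ q ∣ →
    SizeHomogeneous n (χ ∘ (⁅ x ⁆ ∪_)) q → LeaderDetermined n χ t s →
    LeaderDetermined n χ (updateAt t x (const (leaderColour χ x q))) (⁅ x ⁆ ∪ s)
  LeaderDetermined-⁅x⁆∪ {t} {x} {q} {s} x∉q s⊆q n≤∣q∣ homogeneous leaders {p} p⊆ p-nonempty ∣p∣≤1+n
    with x ∈? p
  ... | yes x∈p = x , x∈p , (begin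
    χ p                               ≡⟨ cong χ (x∈p⇒⁅x⁆∪p-x≡p x∈p) ⟨
    χ (⁅ x ⁆ ∪ (p - x))               ≡⟨ homogeneous p-x⊆q (prefix⊆ k) ∣p-x∣≡∣prefix∣ ∣p-x∣≤n ⟩
    χ (⁅ x ⁆ ∪ prefix k q)            ≡⟨ cong-app (updateAt-updates x t) k ⟨
    t′ x k                            ≡⟨ cong (t′ x ∘ pred) (x∈p⇒∣p∣≡1+∣p-x∣ x∈p) ⟨
    t′ x (pred ∣ p ∣)                 ∎)
    where
    open ≡-Reasoning
    t′ = updateAt t x (const (leaderColour χ x q))
    k  = ∣ p - x ∣

    p-x⊆q : p - x ⊆ q
    p-x⊆q = s⊆q ∘ p⊆⁅x⁆∪q∧x∉p⇒p⊆q (p⊆ ∘ p─q⊆p p ⁅ x ⁆) (x∉p-x p x)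

    ∣p-x∣≤n : k ≤ n
    ∣p-x∣≤n = ℕₚ.≤-pred (subst (_≤ suc n) (x∈p⇒∣p∣≡1+∣p-x∣ x∈p) ∣p∣≤1+n)

    ∣p-x∣≡∣prefix∣ : k ≡ ∣ prefix k q ∣
    ∣p-x∣≡∣prefix∣ = sym (∣prefix∣≡ k (ℕₚ.≤-trans ∣p-x∣≤n n≤∣q∣))
  ... | no x∉p with y , y∈p , χp≡ ← leaders (p⊆⁅x⁆∪q∧x∉p⇒p⊆q p⊆ x∉p) p-nonempty ∣p∣≤1+n =
    y , y∈p , trans χp≡ (sym (cong-app (updateAt-minimal y x t y≢x) _))
    where
    y≢x : y ≢ x
    y≢x refl = x∉p y∈p

  LeaderDetermined⇒SizeHomogeneous : ∀ {t s h} → LeaderDetermined n χ t s → h ⊆ s →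
    (∀ k → k ℕ.< suc n → ConstantOn (λ x → t x k) h) → SizeHomogeneous (suc n) χ h
  LeaderDetermined⇒SizeHomogeneous {t} {s} {h} leaders h⊆s constant {p} {q} p⊆h q⊆h ∣p∣≡∣q∣ ∣p∣≤1+n
    with nonempty? p
  ... | no p-empty = cong χ (Empty∧∣p∣≡∣q∣⇒p≡q p-empty ∣p∣≡∣q∣)
  ... | yes p-nonempty@(x , x∈p) = begin
    χ p               ≡⟨ χ≡t p⊆h p-nonempty ∣p∣≤1+n (p⊆h x∈p) ⟩
    t x (pred ∣ p ∣)  ≡⟨ cong (t x ∘ pred) ∣p∣≡∣q∣ ⟩
    t x (pred ∣ q ∣)  ≡⟨ χ≡t q⊆h q-nonempty (subst (_≤ suc n) ∣p∣≡∣q∣ ∣p∣≤1+n) (p⊆h x∈p) ⟨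
    χ q               ∎
    where
    open ≡-Reasoning
    q-nonempty = ∣p∣>0⇒Nonempty (subst (0 ℕ.<_) ∣p∣≡∣q∣ (Nonempty⇒∣p∣>0 p-nonempty))

    χ≡t : ∀ {r} → r ⊆ h → Nonempty r → ∣ r ∣ ≤ suc n → ∀ {z} → z ∈ h → χ r ≡ t z (pred ∣ r ∣)
    χ≡t r⊆h r-nonempty ∣r∣≤1+n z∈h =
      let y , y∈r , χr≡ = leaders (h⊆s ∘ r⊆h) r-nonempty ∣r∣≤1+n
      in  trans χr≡ (constant _ (s≤s (ℕₚ.pred-mono-≤ ∣r∣≤1+n)) (r⊆h y∈r) z∈h)

module _ {n : ℕ} (ramsey-n : Ramsey n) (c : ℕ) where

  -- The ⊔ n makes each set obtained from the induction hypothesis large enough to contain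
  -- subsets of every size ≤ n.
  greedyBound : ℕ → ℕ
  greedyBound zero    = 0
  greedyBound (suc L) = suc (proj₁ (ramsey-n (greedyBound L ⊔ n) c))

  leaderDeterminedSubset : ∀ L (χ : Subset N → ℕ) → (∀ p → χ p ≤ c) →
    ∀ {s} → greedyBound L ≤ ∣ s ∣ →
    ∃ λ h → ∃ λ t → h ⊆ s × L ≤ ∣ h ∣ × (∀ x k → t x k ≤ c) × LeaderDetermined n χ t h
  leaderDeterminedSubset zero χ χ≤c _ =
    ⊥ , (λ _ _ → 0) , ⊥⊆ , z≤n , (λ _ _ → z≤n) , λ p⊆⊥ (x , x∈p) _ → contradiction (p⊆⊥ x∈p) ∉⊥
  leaderDeterminedSubset (suc L) χ χ≤c {s} size
    with x , x∈s ← ∣p∣>0⇒Nonempty (ℕₚ.<-≤-trans (s≤s z≤n) size)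
    with q , q⊆s-x , size-q , homogeneous ← proj₂ (ramsey-n (greedyBound L ⊔ n) c)
           (χ ∘ (⁅ x ⁆ ∪_)) (χ≤c ∘ (⁅ x ⁆ ∪_)) (s - x)
           (ℕₚ.≤-pred (subst (_ ≤_) (x∈p⇒∣p∣≡1+∣p-x∣ x∈s) size))
    with h , t , h⊆q , L≤∣h∣ , t≤c , leaders ← leaderDeterminedSubset L χ χ≤c
                                                  (ℕₚ.≤-trans (ℕₚ.m≤m⊔n _ n) size-q)
    = ⁅ x ⁆ ∪ h , updateAt t x (const (leaderColour χ x q)) ,
      x∈q∧p⊆q⇒⁅x⁆∪p⊆q x∈s (p─q⊆p s ⁅ x ⁆ ∘ q⊆s-x ∘ h⊆q) , L+1≤∣⁅x⁆∪h∣ , t′≤c ,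
      LeaderDetermined-⁅x⁆∪ x∉q h⊆q (ℕₚ.≤-trans (ℕₚ.m≤n⊔m _ n) size-q) homogeneous leaders
    where
    x∉q : x ∉ q
    x∉q = x∉p-x s x ∘ q⊆s-x

    L+1≤∣⁅x⁆∪h∣ : suc L ≤ ∣ ⁅ x ⁆ ∪ h ∣
    L+1≤∣⁅x⁆∪h∣ = subst (suc L ≤_) (sym (∣⁅x⁆∪p∣≡1+∣p∣ (x∉q ∘ h⊆q))) (s≤s L≤∣h∣)

    t′≤c : ∀ y k → updateAt t x (const (leaderColour χ x q)) y k ≤ c
    t′≤c y k with y Fin.≟ x
    ... | yes refl = subst (_≤ c) (sym (cong-app (updateAt-updates x t) k)) (χ≤c _)
    ... | no  y≢x  = subst (_≤ c) (sym (cong-app (updateAt-minimal y x t y≢x) k)) (t≤c y k)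

ramsey-suc : ∀ {n} → Ramsey n → Ramsey (suc n)
ramsey-suc {n} ramsey-n m c = greedyBound ramsey-n c (suc c ^ suc n * m) , λ χ χ≤c s size →
  let h , t , h⊆s , size-h , t≤c , leaders = leaderDeterminedSubset ramsey-n c _ χ χ≤c size
      h′ , h′⊆h , m≤∣h′∣ , constant = pigeonhole-levels c (suc n) m t t≤c size-h
  in  h′ , h⊆s ∘ h′⊆h , m≤∣h′∣ , LeaderDetermined⇒SizeHomogeneous leaders h′⊆h constant

ramsey : ∀ n → Ramsey n
ramsey zero    = ramsey-zero
ramsey (suc n) = ramsey-suc (ramsey n)

toℚᵘ-homo-· : ∀ k p → toℚᵘ (k · p) ≃ᵘ k ·ᵘ toℚᵘ p
toℚᵘ-homo-· zero    p = ℚᵘₚ.≃-refl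
toℚᵘ-homo-· (suc k) p = begin
  toℚᵘ (p ℚ.+ k · p)         ≈⟨ ℚₚ.toℚᵘ-homo-+ p (k · p) ⟩
  toℚᵘ p ℚᵘ.+ toℚᵘ (k · p)   ≈⟨ ℚᵘₚ.+-congʳ (toℚᵘ p) (toℚᵘ-homo-· k p) ⟩
  toℚᵘ p ℚᵘ.+ k ·ᵘ toℚᵘ p    ∎
  where open ℚᵘₚ.≃-Reasoning

mkℚᵘ-+ : ∀ a b d → mkℚᵘ a d ℚᵘ.+ mkℚᵘ b d ≃ᵘ mkℚᵘ (a ℤ.+ b) d
mkℚᵘ-+ a b d = *≡* (begin
  (a ℤ.* D ℤ.+ b ℤ.* D) ℤ.* D   ≡⟨ distrib a b D ⟩
  (a ℤ.+ b) ℤ.* (D ℤ.* D)       ≡⟨ cong ((a ℤ.+ b) ℤ.*_) (ℤₚ.pos-* (suc d) (suc d)) ⟨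
  (a ℤ.+ b) ℤ.* + (suc d * suc d) ∎)
  where
  open ≡-Reasoning
  D = +[1+ d ]
  distrib : ∀ a b D → (a ℤ.* D ℤ.+ b ℤ.* D) ℤ.* D ≡ (a ℤ.+ b) ℤ.* (D ℤ.* D)
  distrib = solve-∀

·-mkℚᵘ : ∀ k a d → k ·ᵘ mkℚᵘ a d ≃ᵘ mkℚᵘ (+ k ℤ.* a) d
·-mkℚᵘ zero    a d = *≡* refl
·-mkℚᵘ (suc k) a d = begin
  mkℚᵘ a d ℚᵘ.+ k ·ᵘ mkℚᵘ a d          ≈⟨ ℚᵘₚ.+-congʳ (mkℚᵘ a d) (·-mkℚᵘ k a d) ⟩
  mkℚᵘ a d ℚᵘ.+ mkℚᵘ (+ k ℤ.* a) d     ≈⟨ mkℚᵘ-+ a (+ k ℤ.* a) d ⟩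
  mkℚᵘ (a ℤ.+ + k ℤ.* a) d             ≡⟨ cong (λ i → mkℚᵘ i d) (ℤₚ.suc-* (+ k) a) ⟨
  mkℚᵘ (+ suc k ℤ.* a) d               ∎
  where open ℚᵘₚ.≃-Reasoning

-- With ε = (a + 1)/(d + 1), the multiple (d + 1) · ε is the integer a + 1.
archimedean : ∀ ε → 0ℚ < ε → ∃ λ M → 1ℚ ℚ.≤ M · ε
archimedean ε@(mkℚ +[1+ a ] d _) _ = suc d , ℚₚ.toℚᵘ-cancel-≤ (begin
  toℚᵘ 1ℚ                             ≤⟨ 1≤[d+1][a+1]/[d+1] ⟩
  mkℚᵘ (+ suc d ℤ.* +[1+ a ]) d       ≃⟨ ·-mkℚᵘ (suc d) +[1+ a ] d ⟨
  suc d ·ᵘ toℚᵘ ε                     ≃⟨ toℚᵘ-homo-· (suc d) ε ⟨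
  toℚᵘ (suc d · ε)                    ∎)
  where
  open ℚᵘₚ.≤-Reasoning
  1≤[d+1][a+1]/[d+1] : toℚᵘ 1ℚ ℚᵘ.≤ mkℚᵘ (+ suc d ℤ.* +[1+ a ]) d
  1≤[d+1][a+1]/[d+1] = *≤* (subst₂ ℤ._≤_ (sym (ℤₚ.*-identityˡ _)) (sym (ℤₚ.*-identityʳ _))
                                        (ℤ.+≤+ (ℕₚ.m≤m*n (suc d) (suc a))))
archimedean (mkℚ (+ 0)      _ _) (*<* (ℤ.+<+ ()))
archimedean (mkℚ ℤ.-[1+ _ ] _ _) (*<* ())

module _ {P : Pred ℕ ℓ} (P? : Decidable P) where

  greatest : ℕ → ℕ
  greatest zero = zero
  greatest (suc M) with P? (suc M)
  ... | yes _ = suc M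
  ... | no  _ = greatest M

  greatest≤ : ∀ M → greatest M ≤ M
  greatest≤ zero = z≤n
  greatest≤ (suc M) with P? (suc M)
  ... | yes _ = ℕₚ.≤-refl
  ... | no  _ = ℕₚ.m≤n⇒m≤1+n (greatest≤ M)

  greatest-sound : ∀ M → greatest M ≡ 0 ⊎ P (greatest M)
  greatest-sound zero = inj₁ refl
  greatest-sound (suc M) with P? (suc M)
  ... | yes PM = inj₂ PM
  ... | no  _  = greatest-sound M

  greatest-maximal : ∀ M → greatest M ≡ M ⊎ ¬ P (suc (greatest M))
  greatest-maximal zero = inj₁ refl
  greatest-maximal (suc M) with P? (suc M)
  ... | yes _  = inj₁ refl
  ... | no ¬PM with greatest-maximal M
  ...   | inj₁ g≡M = inj₂ (subst (¬_ ∘ P ∘ suc) (sym g≡M) ¬PM)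
  ...   | inj₂ ¬P  = inj₂ ¬P

module Grid (ε : ℚ) (ε>0 : 0ℚ < ε) where

  M : ℕ
  M = proj₁ (archimedean ε ε>0)

  -- The clause k · ε ≤ 1 keeps the grid values in [0,1] also where f_A is unconstrained
  -- (on ∅), which the counting strategy needs.
  GridPointBelow : ℚ → Pred ℕ _
  GridPointBelow q k = k · ε ℚ.≤ q × k · ε ℚ.≤ 1ℚ

  gridPointBelow? : ∀ q → Decidable (GridPointBelow q)
  gridPointBelow? q k = (k · ε ℚₚ.≤? q) ×-dec (k · ε ℚₚ.≤? 1ℚ)

  level : ℚ → ℕ
  level q = greatest (gridPointBelow? q) M

  level≤M : ∀ q → level q ≤ M
  level≤M q = greatest≤ (gridPointBelow? q) M

  ·ε-nonneg : ∀ k → 0ℚ ℚ.≤ k · ε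
  ·ε-nonneg zero    = ℚₚ.≤-refl
  ·ε-nonneg (suc k) = ℚₚ.+-mono-≤ (ℚₚ.<⇒≤ ε>0) (·ε-nonneg k)

  level·ε≤1 : ∀ q → level q · ε ℚ.≤ 1ℚ
  level·ε≤1 q with greatest-sound (gridPointBelow? q) M
  ... | inj₁ level≡0    = subst (λ k → k · ε ℚ.≤ 1ℚ) (sym level≡0) (ℚₚ.nonNegative⁻¹ 1ℚ)
  ... | inj₂ (_ , ·ε≤1) = ·ε≤1

  level·ε≤ : ∀ q → 0ℚ ℚ.≤ q → level q · ε ℚ.≤ q
  level·ε≤ q 0≤q with greatest-sound (gridPointBelow? q) M
  ... | inj₁ level≡0    = subst (λ k → k · ε ℚ.≤ q) (sym level≡0) 0≤q
  ... | inj₂ (·ε≤q , _) = ·ε≤q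

  ≤level·ε+ε : ∀ q → q ℚ.≤ 1ℚ → q ℚ.≤ level q · ε ℚ.+ ε
  ≤level·ε+ε q q≤1 = subst (q ℚ.≤_) (ℚₚ.+-comm ε (level q · ε)) ≤suc-level·ε
    where
    ≤suc-level·ε : q ℚ.≤ suc (level q) · ε
    ≤suc-level·ε with greatest-maximal (gridPointBelow? q) M
    ... | inj₁ level≡M = begin
      q                    ≤⟨ q≤1 ⟩
      1ℚ                   ≤⟨ proj₂ (archimedean ε ε>0) ⟩
      M · ε                ≡⟨ ℚₚ.+-identityˡ (M · ε) ⟨
      0ℚ ℚ.+ M · ε         ≤⟨ ℚₚ.+-monoˡ-≤ (M · ε) (ℚₚ.<⇒≤ ε>0) ⟩
      ε ℚ.+ M · ε          ≡⟨ cong (λ k → suc k · ε) level≡M ⟨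
      suc (level q) · ε    ∎
      where open ℚₚ.≤-Reasoning
    ... | inj₂ ¬below with suc (level q) · ε ℚₚ.≤? q
    ...   | yes ·ε≤q = ℚₚ.≤-trans q≤1 (ℚₚ.<⇒≤ (ℚₚ.≰⇒> (¬below ∘ (·ε≤q ,_))))
    ...   | no  ·ε≰q = ℚₚ.<⇒≤ (ℚₚ.≰⇒> ·ε≰q)

  quantized : (ℕ → ℚ) → CountingStrategy
  quantized r = record
    { p    = λ k → level (r k) · ε
    ; p-≥0 = λ k → ·ε-nonneg (level (r k))
    ; p-≤1 = λ k → level·ε≤1 (r k)
    }

  approxOn-homogeneous : ∀ {n} (A : ObliviousOCRS N) {S} → SizeHomogeneous n (level ∘ f A) S →
                         ApproxOn ε n A (quantized (λ k → f A (prefix k S))) S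
  approxOn-homogeneous A {S} homogeneous T T⊆S T-nonempty ∣T∣≤n = lower , upper
    where
    same-level : level (f A T) ≡ level (f A (prefix ∣ T ∣ S))
    same-level = homogeneous T⊆S (prefix⊆ ∣ T ∣) (sym (∣prefix∣≡ ∣ T ∣ (p⊆q⇒∣p∣≤∣q∣ T⊆S))) ∣T∣≤n

    lower = subst (λ k → k · ε ℚ.≤ f A T) same-level
              (level·ε≤ (f A T) (f-≥0 A T T-nonempty))
    upper = subst (λ k → f A T ℚ.≤ k · ε ℚ.+ ε) same-level
              (≤level·ε+ε (f A T) (f-≤1 A T T-nonempty))

-- The statement holds for all n and m.
mainTheorem6 : ∀ (n m : ℕ) → NonZero n → NonZero m → (ε : ℚ) → 0ℚ < ε →
    ∃ λ (N₀ : ℕ) → ∀ (N : ℕ) → N ≥ N₀ → ∀ (A : ObliviousOCRS N) →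
      Σ (Subset N) λ S → (∣ S ∣ ≡ m) ×
        (∃ λ (c : CountingStrategy) → ApproxOn ε n A c S)
mainTheorem6 n m _ _ ε ε>0 = proj₁ (ramsey n m M) , λ N N≥K A →
  let h , _ , m≤∣h∣ , homogeneous = proj₂ (ramsey n m M) (level ∘ f A) (level≤M ∘ f A) ⊤
                                      (subst (_ ≤_) (sym (∣⊤∣≡n N)) N≥K)
      S = prefix m h
  in  S , ∣prefix∣≡ m m≤∣h∣ , quantized (λ k → f A (prefix k S)) ,
      approxOn-homogeneous A (SizeHomogeneous-⊆ (prefix⊆ m) homogeneous)
  where open Grid ε ε>0
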